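{- Every sink-free digraph $D$ that has a good quasi-kernel has a quasi-kernel of size at most $|V(D)|/2$.
   Context: A quasi-kernel of a digraph $D$ is an independent set $Q\subseteq V(D)$ such that for every vertex $v\in V(D)\setminus Q$ there is a directed path with one or two arcs from $v$ to some vertex of $Q$. A quasi-kernel $Q$ is good if for each $u\in Q$ there is an arc from $u$ to a vertex which is an in-neighbour of some vertex of $Q$. $D$ is sink-free if every vertex has an out-neighbour. -}

module Defs where

open import Data.Nat using (ℕ; _*_; _≤_)
open import Data.Bool using (Bool; true; false)
open import Data.Fin using (Fin)
open import Data.Fin.Subset using (Subset; _∈_; _∉_; ∣_∣)
open import Data.Product using (Σ; _×_; ∃-syntax)
open import Data.Sum using (_⊎_)
open import Relation.Nullary using (¬_)
open import Relation.Binary.PropositionalEquality using (_≡_)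

-- A (finite, loopless) digraph on the vertex set Fin n.
-- Arcs are given by a Boolean adjacency function; multiple arcs are
-- irrelevant here, and opposite arcs u→v, v→u are allowed.
record Digraph (n : ℕ) : Set where
  field
    arc      : Fin n → Fin n → Bool
    loopless : ∀ v → arc v v ≡ false

open Digraph public

_⟶[_]_ : ∀ {n} → Fin n → Digraph n → Fin n → Set
u ⟶[ D ] v = arc D u v ≡ true

SinkFree : ∀ {n} → Digraph n → Set
SinkFree {n} D = ∀ (v : Fin n) → ∃[ w ] (v ⟶[ D ] w)

Independent : ∀ {n} → Digraph n → Subset n → Set
Independent {n} D Q = ∀ (u v : Fin n) → u ∈ Q → v ∈ Q → ¬ (u ⟶[ D ] v)

ReachesIn≤2 : ∀ {n} → Digraph n → Subset n → Fin n → Set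
ReachesIn≤2 {n} D Q v =
  ∃[ q ] (q ∈ Q × ((v ⟶[ D ] q) ⊎ ∃[ w ] ((v ⟶[ D ] w) × (w ⟶[ D ] q))))

QuasiKernel : ∀ {n} → Digraph n → Subset n → Set
QuasiKernel {n} D Q =
  Independent D Q × (∀ (v : Fin n) → v ∉ Q → ReachesIn≤2 D Q v)

GoodQuasiKernel : ∀ {n} → Digraph n → Subset n → Set
GoodQuasiKernel {n} D Q =
  QuasiKernel D Q ×
  (∀ (u : Fin n) → u ∈ Q →
     ∃[ w ] ((u ⟶[ D ] w) × ∃[ q ] (q ∈ Q × (w ⟶[ D ] q))))

{-# OPTIONS --safe #-}
module Submission where

-- Let Q be a good quasi-kernel. Choose S ⊆ Q containing, for every vertex
-- outside Q with an out-neighbour in Q, one such out-neighbour; then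
-- |S| ≤ min(|Q|, n − |Q|) ≤ n/2. S is still a quasi-kernel: a vertex u of Q
-- reaches S along its good path u → w → Q, since w ∉ Q by independence and so
-- w has an out-neighbour in S; and a path of length one or two from a vertex
-- outside Q into Q can be rerouted into S at its last vertex outside Q.

open import Defs
open import Data.Nat using (ℕ; suc; _*_; _+_; _≤_; z≤n; s≤s)
open import Data.Nat.Properties
  using (≤-trans; ≤-reflexive; n≤1+n; m≤n⇒m≤1+n; +-suc; +-identityʳ; +-monoʳ-≤;
         m≤o∸n⇒m+n≤o; module ≤-Reasoning)
open import Data.Bool using (true) renaming (_≟_ to _≟ᴮ_)
open import Data.Fin using (Fin; zero; suc)
open import Data.Fin.Properties using (any?)
open import Data.Fin.Subset using (Subset; inside; outside; _∈_; _∉_; _⊆_; _∪_; ⁅_⁆; ∁; ⊥; ∣_∣)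
open import Data.Fin.Subset.Properties
  using (_∈?_; ⊥⊆; ∣⊥∣≡0; x∈p∪q⁺; x∈p∪q⁻; x∈⁅x⁆; x∈⁅y⁆⇒x≡y; ∣⁅x⁆∣≡1;
         p⊆q⇒∣p∣≤∣q∣; ∣p∣≤n; ∣∁p∣≡n∸∣p∣; x∉p⇒x∈∁p)
open import Data.Vec.Base using ([]; _∷_; here; there)
open import Data.Product using (_×_; _,_; ∃-syntax)
open import Data.Sum using (inj₁; inj₂)
open import Data.Empty using (⊥-elim)
open import Relation.Nullary using (Dec; yes; no)
open import Relation.Nullary.Decidable using (_×-dec_)
open import Relation.Binary.PropositionalEquality using (sym; cong; subst)

∣p∪q∣≤∣p∣+∣q∣ : ∀ {n} (p q : Subset n) → ∣ p ∪ q ∣ ≤ ∣ p ∣ + ∣ q ∣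
∣p∪q∣≤∣p∣+∣q∣ []            []            = z≤n
∣p∪q∣≤∣p∣+∣q∣ (inside ∷ p)  (inside ∷ q)  =
  s≤s (≤-trans (∣p∪q∣≤∣p∣+∣q∣ p q) (+-monoʳ-≤ ∣ p ∣ (n≤1+n ∣ q ∣)))
∣p∪q∣≤∣p∣+∣q∣ (inside ∷ p)  (outside ∷ q) = s≤s (∣p∪q∣≤∣p∣+∣q∣ p q)
∣p∪q∣≤∣p∣+∣q∣ (outside ∷ p) (inside ∷ q)  =
  ≤-trans (s≤s (∣p∪q∣≤∣p∣+∣q∣ p q)) (≤-reflexive (sym (+-suc ∣ p ∣ ∣ q ∣)))
∣p∪q∣≤∣p∣+∣q∣ (outside ∷ p) (outside ∷ q) = ∣p∪q∣≤∣p∣+∣q∣ p q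

⁅⁆∪⊆ : ∀ {n} {p q : Subset n} {x : Fin n} → x ∈ q → p ⊆ q → ⁅ x ⁆ ∪ p ⊆ q
⁅⁆∪⊆ {p = p} {x = x} x∈q p⊆q y∈⁅x⁆∪p with x∈p∪q⁻ ⁅ x ⁆ p y∈⁅x⁆∪p
... | inj₁ y∈⁅x⁆ = subst (_∈ _) (sym (x∈⁅y⁆⇒x≡y x y∈⁅x⁆)) x∈q
... | inj₂ y∈p    = p⊆q y∈p

p⊆q∧∣p∣≤∣∁q∣⇒2*∣p∣≤n : ∀ {n} {p q : Subset n} → p ⊆ q → ∣ p ∣ ≤ ∣ ∁ q ∣ → 2 * ∣ p ∣ ≤ n
p⊆q∧∣p∣≤∣∁q∣⇒2*∣p∣≤n {n} {p} {q} p⊆q ∣p∣≤∣∁q∣ = begin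
  2 * ∣ p ∣           ≡⟨ cong (∣ p ∣ +_) (+-identityʳ ∣ p ∣) ⟩
  ∣ p ∣ + ∣ p ∣       ≤⟨ +-monoʳ-≤ ∣ p ∣ (p⊆q⇒∣p∣≤∣q∣ p⊆q) ⟩
  ∣ p ∣ + ∣ q ∣       ≤⟨ m≤o∸n⇒m+n≤o ∣ p ∣ (∣p∣≤n q) (subst (∣ p ∣ ≤_) (∣∁p∣≡n∸∣p∣ q) ∣p∣≤∣∁q∣) ⟩
  n                   ∎
  where open ≤-Reasoning

SuccessorIn : ∀ {a} {A : Set a} {k} → (A → Fin k → Set) → Subset k → A → Set
SuccessorIn R T x = ∃[ t ] (t ∈ T × R x t)

successorIn? : ∀ {a} {A : Set a} {k} {R : A → Fin k → Set} →
               (∀ x t → Dec (R x t)) → ∀ T x → Dec (SuccessorIn R T x)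
successorIn? R? T x = any? (λ t → (t ∈? T) ×-dec R? x t)

select-successors : ∀ {m k} (R : Fin m → Fin k → Set) → (∀ x t → Dec (R x t)) →
  (Q : Subset k) (P : Subset m) →
  ∃[ T ] (T ⊆ Q × ∣ T ∣ ≤ ∣ P ∣ ×
          (∀ x → x ∈ P → SuccessorIn R Q x → SuccessorIn R T x))
select-successors {k = k} R R? Q [] = ⊥ , ⊥⊆ , ≤-reflexive (∣⊥∣≡0 k) , λ _ ()
select-successors R R? Q (outside ∷ P)
  with T , T⊆Q , ∣T∣≤∣P∣ , keeps ← select-successors (λ x → R (suc x)) (λ x → R? (suc x)) Q P
  = T , T⊆Q , ∣T∣≤∣P∣ , λ { (suc x) (there x∈P) → keeps x x∈P }
select-successors R R? Q (inside ∷ P)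
  with T , T⊆Q , ∣T∣≤∣P∣ , keeps ← select-successors (λ x → R (suc x)) (λ x → R? (suc x)) Q P
     | successorIn? R? Q zero
... | no none = T , T⊆Q , m≤n⇒m≤1+n ∣T∣≤∣P∣ , λ
  { zero    here        has → ⊥-elim (none has)
  ; (suc x) (there x∈P) has → keeps x x∈P has }
... | yes (t , t∈Q , Rzt) = ⁅ t ⁆ ∪ T , ⁅⁆∪⊆ t∈Q T⊆Q , size , λ
  { zero    here        _   → t , x∈p∪q⁺ (inj₁ (x∈⁅x⁆ t)) , Rzt
  ; (suc x) (there x∈P) has → let (u , u∈T , Rxu) = keeps x x∈P has
                              in  u , x∈p∪q⁺ (inj₂ u∈T) , Rxu }
  where
  size : ∣ ⁅ t ⁆ ∪ T ∣ ≤ suc ∣ P ∣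
  size = begin
    ∣ ⁅ t ⁆ ∪ T ∣      ≤⟨ ∣p∪q∣≤∣p∣+∣q∣ ⁅ t ⁆ T ⟩
    ∣ ⁅ t ⁆ ∣ + ∣ T ∣  ≡⟨ cong (_+ ∣ T ∣) (∣⁅x⁆∣≡1 t) ⟩
    suc ∣ T ∣          ≤⟨ s≤s ∣T∣≤∣P∣ ⟩
    suc ∣ P ∣          ∎
    where open ≤-Reasoning

module _ {n : ℕ} (D : Digraph n) where

  OutNeighbourIn : Subset n → Fin n → Set
  OutNeighbourIn = SuccessorIn (λ u v → u ⟶[ D ] v)

  arc? : ∀ u v → Dec (u ⟶[ D ] v)
  arc? u v = arc D u v ≟ᴮ true

  independent-⊆ : ∀ {Q S} → S ⊆ Q → Independent D Q → Independent D S
  independent-⊆ S⊆Q indep u v u∈S v∈S = indep u v (S⊆Q u∈S) (S⊆Q v∈S)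

  good⇒quasiKernel-⊆ : ∀ {Q S} → GoodQuasiKernel D Q → S ⊆ Q →
    (∀ v → v ∉ Q → OutNeighbourIn Q v → OutNeighbourIn S v) →
    QuasiKernel D S
  good⇒quasiKernel-⊆ {Q} {S} ((indep , reach) , good) S⊆Q keeps =
    independent-⊆ S⊆Q indep , λ v _ → reachesS v
    where
    oneArc : ∀ {v q} → v ∉ Q → q ∈ Q → v ⟶[ D ] q → ReachesIn≤2 D S v
    oneArc v∉Q q∈Q vq =
      let (s , s∈S , vs) = keeps _ v∉Q (_ , q∈Q , vq) in s , s∈S , inj₁ vs

    twoArcs : ∀ {v w q} → v ⟶[ D ] w → w ∉ Q → q ∈ Q → w ⟶[ D ] q → ReachesIn≤2 D S v
    twoArcs vw w∉Q q∈Q wq =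
      let (s , s∈S , ws) = keeps _ w∉Q (_ , q∈Q , wq) in s , s∈S , inj₂ (_ , vw , ws)

    reachesS : ∀ v → ReachesIn≤2 D S v
    reachesS v with v ∈? Q
    ... | yes v∈Q =
      let (w , vw , q , q∈Q , wq) = good v v∈Q
      in  twoArcs vw (λ w∈Q → indep v w v∈Q w∈Q vw) q∈Q wq
    ... | no v∉Q with reach v v∉Q
    ...   | q , q∈Q , inj₁ vq = oneArc v∉Q q∈Q vq
    ...   | q , q∈Q , inj₂ (w , vw , wq) with w ∈? Q
    ...     | yes w∈Q = oneArc v∉Q w∈Q vw
    ...     | no  w∉Q = twoArcs vw w∉Q q∈Q wq

theorem5 : ∀ (n : ℕ) (D : Digraph n) → SinkFree D →
    ∃[ Q ] GoodQuasiKernel D Q →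
    ∃[ Q ] (QuasiKernel D Q × 2 * ∣ Q ∣ ≤ n)
theorem5 n D _ (Q , goodQ) =
  let (S , S⊆Q , ∣S∣≤∣∁Q∣ , keeps) =
        select-successors (λ u v → u ⟶[ D ] v) (arc? D) Q (∁ Q)
  in  S
    , good⇒quasiKernel-⊆ D goodQ S⊆Q (λ v v∉Q → keeps v (x∉p⇒x∈∁p v∉Q))
    , p⊆q∧∣p∣≤∣∁q∣⇒2*∣p∣≤n S⊆Q ∣S∣≤∣∁Q∣
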